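{- Let $P_n$ be the path on $n\geq 1$ vertices. Then $$\chi_{md}(P_n)=\begin{cases}1,& n=1,\\ 2,& 2\leq n\leq 5,\\ 3,& 6\leq n\leq 10,\\ 4,& 11\leq n\leq 13,\\ \left\lceil \frac{n}{6}\right\rceil+2,& n\geq 14.\end{cases}$$
   Context: For a vertex $v$, $N[v]=N(v)\cup\{v\}$; $v$ dominates exactly the vertices of $N[v]$. A majority dominator coloring of $G$ is a proper vertex coloring such that for every vertex $v$ there is a color class $C$ with $|N[v]\cap C|\geq |C|/2$. $\chi_{md}(G)$ is the minimum number of color classes in a majority dominator coloring of $G$. -}

module Defs where

open import Data.Nat using (ℕ; zero; suc; _+_; _*_; _≤_; _/_; ∣_-_∣)
import Data.Nat as ℕ
open import Data.Fin using (Fin; toℕ; _≟_)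
open import Data.List using (map; allFin)
open import Data.Nat.ListAction using (sum)
open import Data.Product using (Σ; ∃; _×_)
open import Data.Sum using (_⊎_)
open import Function.Definitions using (Surjective)
open import Relation.Binary.PropositionalEquality using (_≡_; _≢_)
open import Relation.Nullary using (Dec; yes; no; ¬_)
open import Relation.Nullary.Decidable using (_⊎-dec_)

record Graph (n : ℕ) : Set₁ where
  field
    Adj  : Fin n → Fin n → Set
    adj? : (u v : Fin n) → Dec (Adj u v)
open Graph public

InN[_] : {n : ℕ} (G : Graph n) → Fin n → Fin n → Set
InN[ G ] v u = (u ≡ v) ⊎ Adj G v u

inN? : {n : ℕ} (G : Graph n) (v u : Fin n) → Dec (InN[ G ] v u)
inN? G v u = (u ≟ v) ⊎-dec adj? G v u

𝟙 : {P : Set} → Dec P → ℕ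
𝟙 (yes _) = 1
𝟙 (no _)  = 0

classSize : {n k : ℕ} → (Fin n → Fin k) → Fin k → ℕ
classSize {n} c a = sum (map (λ u → 𝟙 (c u ≟ a)) (allFin n))

nbhdClassSize : {n k : ℕ} (G : Graph n) → (Fin n → Fin k) → Fin n → Fin k → ℕ
nbhdClassSize {n} G c v a =
  sum (map (λ u → 𝟙 (inN? G v u) * 𝟙 (c u ≟ a)) (allFin n))

-- Majority dominator colouring with exactly k colour classes:
-- a proper colouring c : Fin n → Fin k, all k classes nonempty (c surjective),
-- such that every vertex v has a class C with |N[v] ∩ C| ≥ |C|/2,
-- written without division as 2·|N[v] ∩ C| ≥ |C|.

record IsMDColoring {n k : ℕ} (G : Graph n) (c : Fin n → Fin k) : Set where
  field
    proper    : ∀ u v → Adj G u v → c u ≢ c v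
    nonempty  : Surjective _≡_ _≡_ c
    majority  : ∀ v → ∃ λ (a : Fin k) → classSize c a ≤ 2 * nbhdClassSize G c v a

HasMDColoring : {n : ℕ} → Graph n → ℕ → Set
HasMDColoring {n} G k = ∃ λ (c : Fin n → Fin k) → IsMDColoring G c

χmd≡ : {n : ℕ} → Graph n → ℕ → Set
χmd≡ G m = HasMDColoring G m × (∀ k → HasMDColoring G k → m ≤ k)

PathAdj : {n : ℕ} → Fin n → Fin n → Set
PathAdj i j = ∣ toℕ i - toℕ j ∣ ≡ 1

P : (n : ℕ) → Graph n
P n = record { Adj = PathAdj ; adj? = λ i j → ∣ toℕ i - toℕ j ∣ ℕ.≟ 1 }

⌈_/6⌉ : ℕ → ℕ
⌈ n /6⌉ = (n + 5) / 6

pathValue : ℕ → ℕ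
pathValue n with n ℕ.≤? 1 | n ℕ.≤? 5 | n ℕ.≤? 10 | n ℕ.≤? 13
... | yes _ | _     | _     | _     = 1
... | no _  | yes _ | _     | _     = 2
... | no _  | no _  | yes _ | _     = 3
... | no _  | no _  | no _  | yes _ = 4
... | no _  | no _  | no _  | no _  = ⌈ n /6⌉ + 2

-- In a path the closed neighbourhood N[v] has at most three vertices and meets the class of v only in v.
-- Hence v is dominated either by a class of at most two vertices meeting N[v], or by the class of both
-- neighbours of v, which then has at most four vertices.  Weigh each vertex of a class of size s ≤ 4 by
-- 12 / s and the others by 0: the total weight W is 12 times the number of classes of size at most 4,
-- and every closed neighbourhood weighs at least 6, so 2n ≤ W.  With at most one class of size ≥ 5,
-- any two of its vertices are separated by a vertex of a class of size ≤ 2, which improves this to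
-- 3n ≤ W + 3; with none, classes of size ≤ 2 occur near both ends and (for n ≥ 13) in the middle.
-- Two colours force an alternating colouring, useless from n = 6 on.  Conversely, small paths are
-- coloured explicitly and longer ones by blocks 0 c 0 1 c 1 with a fresh colour c per block.
module Submission where

open import Algebra.Properties.CommutativeSemigroup using (interchange)
open import Data.Bool.Base using (T)
open import Data.Empty using (⊥)
open import Data.Fin.Base as Fin using (Fin; toℕ; fromℕ<)
import Data.Fin.Properties as Finₚ
open import Data.List.Base using (List; []; _∷_; map; allFin; tabulate; length)
open import Data.List.Properties using (map-tabulate)
open import Data.List.Relation.Unary.All as All using (All; []; _∷_)
open import Data.List.Relation.Unary.AllPairs using (AllPairs; []; _∷_; allPairs?)
open import Data.Nat.Base
open import Data.Nat.DivMod using (m/n*n≤m; m≡m%n+[m/n]*n; m%n<n; /-congˡ; +-distrib-/-∣ʳ; m*n/n≡m)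
open import Data.Nat.Divisibility using (n∣m*n)
open import Data.Nat.ListAction using (sum)
open import Data.Nat.Properties
open import Data.Nat.Tactic.RingSolver using (solve-∀)
open import Data.Product using (∃-syntax; _×_; _,_; proj₁; proj₂)
open import Data.Sum as Sum using (_⊎_; inj₁; inj₂)
open import Defs
open import Function using (_∘_; id)
open import Relation.Binary.Definitions using (tri<; tri≈; tri>)
open import Relation.Binary.PropositionalEquality
open import Relation.Nullary using (Dec; yes; no; ¬_; contradiction)
open import Relation.Nullary.Decidable using (_⊎-dec_; _×-dec_; _→-dec_; ¬?; from-yes; map′; From-yes)

-- Finite sums and counting

∑ : ℕ → (ℕ → ℕ) → ℕ
∑ zero    f = 0
∑ (suc n) f = f 0 + ∑ n (f ∘ suc)

syntax ∑ n (λ i → e) = ∑[ i < n ] e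

∑-cong : ∀ n {f g : ℕ → ℕ} → (∀ {i} → i < n → f i ≡ g i) → ∑ n f ≡ ∑ n g
∑-cong zero    _  = refl
∑-cong (suc n) eq = cong₂ _+_ (eq z<s) (∑-cong n (eq ∘ s<s))

∑-mono-≤ : ∀ n {f g : ℕ → ℕ} → (∀ {i} → i < n → f i ≤ g i) → ∑ n f ≤ ∑ n g
∑-mono-≤ zero    _  = z≤n
∑-mono-≤ (suc n) le = +-mono-≤ (le z<s) (∑-mono-≤ n (le ∘ s<s))

∑-distrib-+ : ∀ n (f g : ℕ → ℕ) → ∑[ i < n ] (f i + g i) ≡ ∑ n f + ∑ n g
∑-distrib-+ zero    f g = refl
∑-distrib-+ (suc n) f g =
  trans (cong (f 0 + g 0 +_) (∑-distrib-+ n (f ∘ suc) (g ∘ suc))) (interchange +-commutativeSemigroup (f 0) (g 0) _ _)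

∑-*ˡ : ∀ n c (f : ℕ → ℕ) → ∑[ i < n ] (c * f i) ≡ c * ∑ n f
∑-*ˡ zero    c f = sym (*-zeroʳ c)
∑-*ˡ (suc n) c f = trans (cong (c * f 0 +_) (∑-*ˡ n c (f ∘ suc))) (sym (*-distribˡ-+ c (f 0) _))

∑-*ʳ : ∀ n c (f : ℕ → ℕ) → ∑[ i < n ] (f i * c) ≡ ∑ n f * c
∑-*ʳ n c f = begin
  ∑[ i < n ] (f i * c)  ≡⟨ ∑-cong n (λ {i} _ → *-comm (f i) c) ⟩
  ∑[ i < n ] (c * f i)  ≡⟨ ∑-*ˡ n c f ⟩
  c * ∑ n f             ≡⟨ *-comm c _ ⟩
  ∑ n f * c             ∎
  where open ≡-Reasoning

∑-const : ∀ n c → ∑[ _ < n ] c ≡ n * c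
∑-const zero    c = refl
∑-const (suc n) c = cong (c +_) (∑-const n c)

∑-zero : ∀ n → ∑[ _ < n ] 0 ≡ 0
∑-zero n = trans (∑-const n 0) (*-zeroʳ n)

∑-snoc : ∀ n (f : ℕ → ℕ) → ∑ (suc n) f ≡ ∑ n f + f n
∑-snoc zero    f = +-comm (f 0) 0
∑-snoc (suc n) f = trans (cong (f 0 +_) (∑-snoc n (f ∘ suc))) (sym (+-assoc (f 0) _ _))

∑-prefix : ∀ {m n} (f : ℕ → ℕ) → m ≤ n → ∑ m f ≤ ∑ n f
∑-prefix {n = n} f z≤n       = z≤n
∑-prefix         f (s≤s m≤n) = +-monoʳ-≤ (f 0) (∑-prefix (f ∘ suc) m≤n)

∑-swap : ∀ m n (f : ℕ → ℕ → ℕ) → ∑[ i < m ] ∑[ j < n ] f i j ≡ ∑[ j < n ] ∑[ i < m ] f i j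
∑-swap zero    n f = sym (trans (∑-const n 0) (*-zeroʳ n))
∑-swap (suc m) n f = trans (cong (∑ n (f 0) +_) (∑-swap m n (f ∘ suc)))
                           (sym (∑-distrib-+ n (f 0) (λ j → ∑[ i < m ] f (suc i) j)))

∑-≥-points : ∀ {n} (f : ℕ → ℕ) {ps} → AllPairs _>_ ps → All (_< n) ps → sum (map f ps) ≤ ∑ n f
∑-≥-points f []                 []             = z≤n
∑-≥-points {n} f {p ∷ ps} (p>ps ∷ desc) (p<n ∷ _) = begin
  f p + sum (map f ps)  ≤⟨ +-monoʳ-≤ (f p) (∑-≥-points f desc p>ps) ⟩
  f p + ∑ p f           ≡⟨ +-comm (f p) _ ⟩
  ∑ p f + f p           ≡⟨ ∑-snoc p f ⟨
  ∑ (suc p) f           ≤⟨ ∑-prefix f p<n ⟩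
  ∑ n f                 ∎
  where open ≤-Reasoning

∑-≥-two : ∀ {n x y} (f : ℕ → ℕ) → x ≢ y → x < n → y < n → f x + f y ≤ ∑ n f
∑-≥-two {x = x} {y} f x≢y x<n y<n with <-cmp x y
... | tri< x<y _ _ = ≤-trans (≤-reflexive (trans (+-comm (f x) (f y)) (cong (f y +_) (sym (+-identityʳ (f x))))))
                              (∑-≥-points f ((x<y ∷ []) ∷ [] ∷ []) (y<n ∷ x<n ∷ []))
... | tri≈ _ x≡y _ = contradiction x≡y x≢y
... | tri> _ _ y<x = ≤-trans (≤-reflexive (cong (f x +_) (sym (+-identityʳ (f y)))))
                              (∑-≥-points f ((y<x ∷ []) ∷ [] ∷ []) (x<n ∷ y<n ∷ []))

𝟙-yes : ∀ {A : Set} (d : Dec A) → A → 𝟙 d ≡ 1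
𝟙-yes (yes _) _ = refl
𝟙-yes (no ¬a) a = contradiction a ¬a

𝟙-no : ∀ {A : Set} (d : Dec A) → ¬ A → 𝟙 d ≡ 0
𝟙-no (yes a) ¬a = contradiction a ¬a
𝟙-no (no _)  _  = refl

𝟙-cong : ∀ {A B : Set} (d : Dec A) (e : Dec B) → (A → B) → (B → A) → 𝟙 d ≡ 𝟙 e
𝟙-cong (yes a) e to _    = sym (𝟙-yes e (to a))
𝟙-cong (no ¬a) e _  from = sym (𝟙-no e (¬a ∘ from))

𝟙-suc≟suc : ∀ m n → 𝟙 (suc m ≟ suc n) ≡ 𝟙 (m ≟ n)
𝟙-suc≟suc m n = 𝟙-cong (suc m ≟ suc n) (m ≟ n) suc-injective (cong suc)

𝟙<?·≡ : ∀ {n j} (f : ℕ → ℕ) → (n ≤ j → f j ≡ 0) → 𝟙 (j <? n) * f j ≡ f j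
𝟙<?·≡ {n} {j} f out with j <? n
... | yes _  = +-identityʳ (f j)
... | no j≮n = sym (out (≮⇒≥ j≮n))

∑-𝟙≟ : ∀ n j (f : ℕ → ℕ) → ∑[ i < n ] (𝟙 (j ≟ i) * f i) ≡ 𝟙 (j <? n) * f j
∑-𝟙≟ zero    j       f = refl
∑-𝟙≟ (suc n) zero    f = trans (cong (1 * f 0 +_) (∑-zero n)) (+-identityʳ (1 * f 0))
∑-𝟙≟ (suc n) (suc j) f = begin
  ∑[ i < n ] (𝟙 (suc j ≟ suc i) * f (suc i))  ≡⟨ ∑-cong n (λ {i} _ → cong (_* f (suc i)) (𝟙-suc≟suc j i)) ⟩
  ∑[ i < n ] (𝟙 (j ≟ i) * f (suc i))          ≡⟨ ∑-𝟙≟ n j (f ∘ suc) ⟩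
  𝟙 (j <? n) * f (suc j)                      ≡⟨ cong (_* f (suc j)) (𝟙-cong (j <? n) (suc j <? suc n) s<s s<s⁻¹) ⟩
  𝟙 (suc j <? suc n) * f (suc j)              ∎
  where open ≡-Reasoning

count-≥ : ∀ {n} {P : ℕ → Set} (P? : ∀ i → Dec (P i)) {ps} →
          AllPairs _>_ ps → All (λ i → i < n × P i) ps → length ps ≤ ∑[ i < n ] 𝟙 (P? i)
count-≥ {n} {P} P? {ps} desc members =
  ≤-trans (≤-reflexive (sym (ones members))) (∑-≥-points (𝟙 ∘ P?) desc (All.map proj₁ members))
  where
  ones : ∀ {qs} → All (λ i → i < n × P i) qs → sum (map (𝟙 ∘ P?) qs) ≡ length qs
  ones []               = refl
  ones ((_ , Pi) ∷ rest) = cong₂ _+_ (𝟙-yes (P? _) Pi) (ones rest)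

∑-by-value : ∀ n k (col F : ℕ → ℕ) → (∀ {i} → i < n → col i < k) →
             ∑[ i < n ] F (col i) ≡ ∑[ a < k ] (∑[ i < n ] 𝟙 (col i ≟ a) * F a)
∑-by-value n k col F col<k = begin
  ∑[ i < n ] F (col i)                        ≡⟨ ∑-cong n (sym ∘ point-mass) ⟩
  ∑[ i < n ] ∑[ a < k ] (𝟙 (col i ≟ a) * F a) ≡⟨ ∑-swap n k _ ⟩
  ∑[ a < k ] ∑[ i < n ] (𝟙 (col i ≟ a) * F a) ≡⟨ ∑-cong k (λ {a} _ → ∑-*ʳ n (F a) _) ⟩
  ∑[ a < k ] (∑[ i < n ] 𝟙 (col i ≟ a) * F a) ∎
  where
  open ≡-Reasoning
  point-mass : ∀ {i} → i < n → ∑[ a < k ] (𝟙 (col i ≟ a) * F a) ≡ F (col i)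
  point-mass {i} i<n =
    trans (∑-𝟙≟ k (col i) F) (trans (cong (_* F (col i)) (𝟙-yes (col i <? k) (col<k i<n))) (*-identityˡ _))

SeparatedBy : (ℕ → Set) → (ℕ → Set) → ℕ → Set
SeparatedBy A L m = ∀ {p q} → p < q → q < m → L p → L q → ∃[ r ] p < r × r < q × A r

module _ {L A : ℕ → Set} (L? : ∀ i → Dec (L i)) (A? : ∀ i → Dec (A i)) where

  private
    #L #A : ℕ → ℕ
    #L m = ∑[ i < m ] 𝟙 (L? i)
    #A m = ∑[ i < m ] 𝟙 (A? i)

    Unanswered : ℕ → Set
    Unanswered m = ∃[ p ] p < m × L p × (∀ {r} → p < r → r < m → ¬ A r)

    -- The L's can only get ahead of the A's through an L that no A has followed yet, and by separation
    -- there is at most one such L.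
    count-invariant : ∀ m → SeparatedBy A L m → #L m ≤ #A m ⊎ (Unanswered m × #L m ≤ #A m + 1)
    count-invariant zero    _   = inj₁ z≤n
    count-invariant (suc m) sep
      rewrite ∑-snoc m (𝟙 ∘ L?) | ∑-snoc m (𝟙 ∘ A?)
      with count-invariant m (λ p<q q<m → sep p<q (m<n⇒m<1+n q<m)) | L? m | A? m
    ... | inj₂ ((p , p<m , Lp , silent) , _) | yes Lm | _ =
      let r , p<r , r<m , Ar = sep p<m ≤-refl Lp Lm in contradiction Ar (silent p<r r<m)
    ... | inj₁ le | yes _  | yes _ = inj₁ (+-monoˡ-≤ 1 le)
    ... | inj₁ le | yes Lm | no _  =
      inj₂ ((m , ≤-refl , Lm , λ m<r r≤m → contradiction (s≤s⁻¹ r≤m) (<⇒≱ m<r)) ,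
            +-monoˡ-≤ 1 (≤-trans le (≤-reflexive (sym (+-identityʳ _)))))
    ... | inj₁ le       | no _ | yes _ = inj₁ (≤-trans (≤-reflexive (+-identityʳ _)) (≤-trans le (m≤m+n _ 1)))
    ... | inj₂ (_ , le) | no _ | yes _ = inj₁ (≤-trans (≤-reflexive (+-identityʳ _)) le)
    ... | inj₁ le       | no _ | no _  = inj₁ (+-monoˡ-≤ 0 le)
    ... | inj₂ ((p , p<m , Lp , silent) , le) | no _ | no ¬Am =
      inj₂ ((p , m<n⇒m<1+n p<m , Lp , silent′) ,
            subst₂ (λ x y → x ≤ y + 1) (sym (+-identityʳ _)) (sym (+-identityʳ _)) le)
      where
      silent′ : ∀ {r} → p < r → r < suc m → ¬ A r
      silent′ {r} p<r r<1+m with r ≟ m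
      ... | yes refl = ¬Am
      ... | no r≢m   = silent p<r (≤∧≢⇒< (s≤s⁻¹ r<1+m) r≢m)

  separated⇒count≤count+1 : ∀ m → SeparatedBy A L m → ∑[ i < m ] 𝟙 (L? i) ≤ ∑[ i < m ] 𝟙 (A? i) + 1
  separated⇒count≤count+1 m sep with count-invariant m sep
  ... | inj₁ le       = ≤-trans le (m≤m+n _ 1)
  ... | inj₂ (_ , le) = le

-- Majority dominator colourings of the path, read on ℕ

∣n-1+n∣≡1 : ∀ n → ∣ n - suc n ∣ ≡ 1
∣n-1+n∣≡1 zero    = refl
∣n-1+n∣≡1 (suc n) = ∣n-1+n∣≡1 n

∣m-n∣≡1⇒adjacent : ∀ m n → ∣ m - n ∣ ≡ 1 → suc m ≡ n ⊎ m ≡ suc n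
∣m-n∣≡1⇒adjacent zero    (suc zero) _  = inj₁ refl
∣m-n∣≡1⇒adjacent (suc zero) zero    _  = inj₂ refl
∣m-n∣≡1⇒adjacent (suc m) (suc n)    eq = Sum.map (cong suc) (cong suc) (∣m-n∣≡1⇒adjacent m n eq)

-- 𝟙 (inN? (P n) v u), read on toℕ v and toℕ u.
inNbhd : ℕ → ℕ → ℕ
inNbhd v i = 𝟙 ((i ≟ v) ⊎-dec (∣ v - i ∣ ≟ 1))

inNbhd-split : ∀ v i → inNbhd v i ≡ 𝟙 (v ≟ suc i) + 𝟙 (v ≟ i) + 𝟙 (suc v ≟ i)
inNbhd-split zero          zero                = refl
inNbhd-split zero          (suc zero)          = refl
inNbhd-split zero          (suc (suc i))       = refl
inNbhd-split (suc zero)    zero                = refl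
inNbhd-split (suc (suc v)) zero                = refl
inNbhd-split (suc v)       (suc i)             = begin
  inNbhd (suc v) (suc i)                                    ≡⟨ 𝟙-cong _ ((i ≟ v) ⊎-dec (∣ v - i ∣ ≟ 1))
                                                                 (Sum.map₁ suc-injective) (Sum.map₁ (cong suc)) ⟩
  inNbhd v i                                                ≡⟨ inNbhd-split v i ⟩
  𝟙 (v ≟ suc i) + 𝟙 (v ≟ i) + 𝟙 (suc v ≟ i)                ≡⟨ sym (cong₂ _+_ (cong₂ _+_ (𝟙-suc≟suc v (suc i)) (𝟙-suc≟suc v i))
                                                                                 (𝟙-suc≟suc (suc v) i)) ⟩
  𝟙 (suc v ≟ suc (suc i)) + 𝟙 (suc v ≟ suc i) + 𝟙 (suc (suc v) ≟ suc i) ∎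
  where open ≡-Reasoning

∑-inNbhd : ∀ {n v} (h : ℕ → ℕ) → h 0 ≡ 0 → h (suc n) ≡ 0 → v < n →
           ∑[ i < n ] (inNbhd v i * h (suc i)) ≡ h v + h (suc v) + h (suc (suc v))
∑-inNbhd {n} {v} h h0 hn v<n = begin
  ∑[ i < n ] (inNbhd v i * h (suc i))
    ≡⟨ ∑-cong n (λ {i} _ → trans (cong (_* h (suc i)) (inNbhd-split v i)) (distrib i)) ⟩
  ∑[ i < n ] (left i + self i + right i)
    ≡⟨ trans (∑-distrib-+ n _ right) (cong (_+ ∑ n right) (∑-distrib-+ n left self)) ⟩
  ∑ n left + ∑ n self + ∑ n right
    ≡⟨ cong₂ _+_ (cong₂ _+_ (∑-left v v<n) (in-range v<n)) in-range-or-last ⟩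
  h v + h (suc v) + h (suc (suc v)) ∎
  where
  open ≡-Reasoning
  left self right : ℕ → ℕ
  left  i = 𝟙 (v ≟ suc i) * h (suc i)
  self  i = 𝟙 (v ≟ i) * h (suc i)
  right i = 𝟙 (suc v ≟ i) * h (suc i)

  distrib : ∀ i → (𝟙 (v ≟ suc i) + 𝟙 (v ≟ i) + 𝟙 (suc v ≟ i)) * h (suc i) ≡ left i + self i + right i
  distrib i = trans (*-distribʳ-+ (h (suc i)) (𝟙 (v ≟ suc i) + _) _)
                    (cong (_+ right i) (*-distribʳ-+ (h (suc i)) (𝟙 (v ≟ suc i)) _))

  in-range : ∀ {j} → j < n → ∑[ i < n ] (𝟙 (j ≟ i) * h (suc i)) ≡ h (suc j)
  in-range {j} j<n = trans (∑-𝟙≟ n j (h ∘ suc)) (𝟙<?·≡ (h ∘ suc) (λ n≤j → contradiction n≤j (<⇒≱ j<n)))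

  in-range-or-last : ∑ n right ≡ h (suc (suc v))
  in-range-or-last = trans (∑-𝟙≟ n (suc v) (h ∘ suc))
    (𝟙<?·≡ (h ∘ suc) (λ n≤1+v → trans (cong (h ∘ suc) (≤-antisym v<n n≤1+v)) hn))

  ∑-left : ∀ u → u < n → ∑[ i < n ] (𝟙 (u ≟ suc i) * h (suc i)) ≡ h u
  ∑-left zero    _   = trans (∑-zero n) (sym h0)
  ∑-left (suc u) u<n =
    trans (∑-cong n (λ {i} _ → cong (_* h (suc i)) (𝟙-suc≟suc u i))) (in-range (<-trans (n<1+n u) u<n))

-- Vertex i of the path sits at position suc i.  Positions 0 and n + 1 carry the colour k, which no
-- vertex has, so the closed neighbourhood of vertex v is always the three positions v, v + 1, v + 2.
pad : ℕ → ℕ → (ℕ → ℕ) → ℕ → ℕ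
pad n k f zero    = k
pad n k f (suc i) with i <? n
... | yes _ = f i
... | no _  = k

pad-vertex : ∀ {n k f i} → i < n → pad n k f (suc i) ≡ f i
pad-vertex {n} {i = i} i<n with i <? n
... | yes _  = refl
... | no i≮n = contradiction i<n i≮n

pad-outside : ∀ {n k f i} → n ≤ i → pad n k f (suc i) ≡ k
pad-outside {n} {i = i} n≤i with i <? n
... | yes i<n = contradiction n≤i (<⇒≱ i<n)
... | no _    = refl

pad-beyond : ∀ {n k f} → pad n k f (suc n) ≡ k
pad-beyond {n} {k} {f} = pad-outside {n} {k} {f} ≤-refl

classCount : ℕ → (ℕ → ℕ) → ℕ → ℕ
classCount n f a = ∑[ i < n ] 𝟙 (f i ≟ a)

classCount-beyond : ∀ {n f a} → (∀ {i} → i < n → f i < a) → classCount n f a ≡ 0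
classCount-beyond {n} {f} {a} f<a = trans (∑-cong n (λ i<n → 𝟙-no (f _ ≟ a) (<⇒≢ (f<a i<n)))) (∑-zero n)

nbhdCount : ℕ → ℕ → (ℕ → ℕ) → ℕ → ℕ → ℕ
nbhdCount n k f v a = 𝟙 (pad n k f v ≟ a) + 𝟙 (pad n k f (suc v) ≟ a) + 𝟙 (pad n k f (suc (suc v)) ≟ a)

record IsPathMD (n k : ℕ) (f : ℕ → ℕ) : Set where
  field
    colour<k : ∀ {i} → i < n → f i < k
    proper   : ∀ {i} → suc i < n → f i ≢ f (suc i)
    onto     : ∀ {a} → a < k → ∃[ i ] i < n × f i ≡ a
    majority : ∀ {v} → v < n → ∃[ a ] a < k × classCount n f a ≤ 2 * nbhdCount n k f v a

module _ {n k : ℕ} {c : Fin n → Fin k} {f : ℕ → ℕ} (represents : ∀ u → f (toℕ u) ≡ toℕ (c u)) where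

  private
    sum-allFin : (h : Fin n → ℕ) (g : ℕ → ℕ) → (∀ u → h u ≡ g (toℕ u)) → sum (map h (allFin n)) ≡ ∑ n g
    sum-allFin h g eq = trans (cong sum (map-tabulate id h)) (go n h g eq)
      where
      go : ∀ m (h : Fin m → ℕ) (g : ℕ → ℕ) → (∀ u → h u ≡ g (toℕ u)) → sum (tabulate h) ≡ ∑ m g
      go zero    h g eq = refl
      go (suc m) h g eq = cong₂ _+_ (eq Fin.zero) (go m (h ∘ Fin.suc) (g ∘ suc) (eq ∘ Fin.suc))

  classSize≡classCount : ∀ a → classSize c a ≡ classCount n f (toℕ a)
  classSize≡classCount a = sum-allFin _ _ λ u →
    𝟙-cong (c u Finₚ.≟ a) (f (toℕ u) ≟ toℕ a)
      (λ cu≡a → trans (represents u) (cong toℕ cu≡a))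
      (λ fu≡a → Finₚ.toℕ-injective (trans (sym (represents u)) fu≡a))

  nbhdClassSize≡nbhdCount : ∀ v a → nbhdClassSize (P n) c v a ≡ nbhdCount n k f (toℕ v) (toℕ a)
  nbhdClassSize≡nbhdCount v a =
    trans (sum-allFin _ _ term) (∑-inNbhd at (𝟙-no (k ≟ toℕ a) k≢a) at-beyond (Finₚ.toℕ<n v))
    where
    at : ℕ → ℕ
    at p = 𝟙 (pad n k f p ≟ toℕ a)

    k≢a : k ≢ toℕ a
    k≢a k≡a = n≮n k (subst (_< k) (sym k≡a) (Finₚ.toℕ<n a))

    at-beyond : at (suc n) ≡ 0
    at-beyond = 𝟙-no (pad n k f (suc n) ≟ toℕ a) (λ eq → k≢a (trans (sym (pad-beyond {n} {k} {f})) eq))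

    term : ∀ u → 𝟙 (inN? (P n) v u) * 𝟙 (c u Finₚ.≟ a) ≡ inNbhd (toℕ v) (toℕ u) * at (suc (toℕ u))
    term u = cong₂ _*_
      (𝟙-cong (inN? (P n) v u) ((toℕ u ≟ toℕ v) ⊎-dec _) (Sum.map₁ (cong toℕ)) (Sum.map₁ Finₚ.toℕ-injective))
      (𝟙-cong (c u Finₚ.≟ a) (pad n k f (suc (toℕ u)) ≟ toℕ a)
        (λ cu≡a → trans (pad-vertex (Finₚ.toℕ<n u)) (trans (represents u) (cong toℕ cu≡a)))
        (λ fu≡a → Finₚ.toℕ-injective (trans (sym (represents u)) (trans (sym (pad-vertex (Finₚ.toℕ<n u))) fu≡a))))

colourOf : ∀ {n k} → (Fin n → Fin k) → ℕ → ℕ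
colourOf {n} c i with i <? n
... | yes i<n = toℕ (c (fromℕ< i<n))
... | no _    = 0

colourOf-toℕ : ∀ {n k} (c : Fin n → Fin k) u → colourOf c (toℕ u) ≡ toℕ (c u)
colourOf-toℕ {n} c u with toℕ u <? n
... | yes u<n = cong (toℕ ∘ c) (Finₚ.fromℕ<-toℕ u u<n)
... | no  u≮n = contradiction (Finₚ.toℕ<n u) u≮n

module _ {n k : ℕ} where

  isPathMD : {c : Fin n → Fin k} → IsMDColoring (P n) c → IsPathMD n k (colourOf c)
  isPathMD {c} md = record { colour<k = colour<k ; proper = proper ; onto = onto ; majority = majority }
    where
    module C = IsMDColoring md
    f = colourOf c

    colour-at : ∀ {i} (i<n : i < n) → f i ≡ toℕ (c (fromℕ< i<n))
    colour-at i<n = trans (cong f (sym (Finₚ.toℕ-fromℕ< i<n))) (colourOf-toℕ c _)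

    colour<k : ∀ {i} → i < n → f i < k
    colour<k i<n = subst (_< k) (sym (colour-at i<n)) (Finₚ.toℕ<n _)

    proper : ∀ {i} → suc i < n → f i ≢ f (suc i)
    proper {i} 1+i<n eq = C.proper (fromℕ< i<n) (fromℕ< 1+i<n) adjacent
      (Finₚ.toℕ-injective (trans (sym (colour-at i<n)) (trans eq (colour-at 1+i<n))))
      where
      i<n = <-trans (n<1+n i) 1+i<n
      adjacent : ∣ toℕ (fromℕ< i<n) - toℕ (fromℕ< 1+i<n) ∣ ≡ 1
      adjacent = subst₂ (λ x y → ∣ x - y ∣ ≡ 1) (sym (Finₚ.toℕ-fromℕ< i<n)) (sym (Finₚ.toℕ-fromℕ< 1+i<n))
                        (∣n-1+n∣≡1 i)

    onto : ∀ {a} → a < k → ∃[ i ] i < n × f i ≡ a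
    onto a<k = let u , cu≡a = C.nonempty (fromℕ< a<k) in
      toℕ u , Finₚ.toℕ<n u , trans (colourOf-toℕ c u) (trans (cong toℕ (cu≡a refl)) (Finₚ.toℕ-fromℕ< a<k))

    majority : ∀ {v} → v < n → ∃[ a ] a < k × classCount n f a ≤ 2 * nbhdCount n k f v a
    majority v<n = let a , le = C.majority (fromℕ< v<n) in
      toℕ a , Finₚ.toℕ<n a ,
      subst₂ (λ x y → x ≤ 2 * y) (classSize≡classCount (colourOf-toℕ c) a)
        (trans (nbhdClassSize≡nbhdCount (colourOf-toℕ c) _ a)
               (cong (λ v → nbhdCount n k f v (toℕ a)) (Finₚ.toℕ-fromℕ< v<n)))
        le

  hasMDColoring : {f : ℕ → ℕ} → IsPathMD n k f → HasMDColoring (P n) k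
  hasMDColoring {f} pmd = c , record { proper = proper ; nonempty = nonempty ; majority = majority }
    where
    module F = IsPathMD pmd

    c : Fin n → Fin k
    c u = fromℕ< (F.colour<k (Finₚ.toℕ<n u))

    represents : ∀ u → f (toℕ u) ≡ toℕ (c u)
    represents u = sym (Finₚ.toℕ-fromℕ< _)

    same-colour : ∀ {u w} → c u ≡ c w → f (toℕ u) ≡ f (toℕ w)
    same-colour {u} {w} eq = trans (represents u) (trans (cong toℕ eq) (sym (represents w)))

    proper : ∀ u w → Adj (P n) u w → c u ≢ c w
    proper u w adj cu≡cw with ∣m-n∣≡1⇒adjacent (toℕ u) (toℕ w) adj
    ... | inj₁ eq = F.proper (subst (_< n) (sym eq) (Finₚ.toℕ<n w)) (trans (same-colour cu≡cw) (cong f (sym eq)))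
    ... | inj₂ eq = F.proper (subst (_< n) eq (Finₚ.toℕ<n u)) (trans (same-colour (sym cu≡cw)) (cong f eq))

    nonempty : ∀ y → ∃[ x ] ∀ {z} → z ≡ x → c z ≡ y
    nonempty y = let i , i<n , fi≡y = F.onto (Finₚ.toℕ<n y) in
      fromℕ< i<n ,
      λ { refl → Finₚ.toℕ-injective (trans (sym (represents _)) (trans (cong f (Finₚ.toℕ-fromℕ< i<n)) fi≡y)) }

    majority : ∀ v → ∃[ a ] classSize c a ≤ 2 * nbhdClassSize (P n) c v a
    majority v = let a , a<k , le = F.majority (Finₚ.toℕ<n v) in
      fromℕ< a<k ,
      subst₂ (λ x y → x ≤ 2 * y)
        (sym (trans (classSize≡classCount represents _) (cong (classCount n f) (Finₚ.toℕ-fromℕ< a<k))))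
        (sym (trans (nbhdClassSize≡nbhdCount represents v _) (cong (nbhdCount n k f (toℕ v)) (Finₚ.toℕ-fromℕ< a<k))))
        le

-- Lower bound

lit≤ : ∀ {m n} {_ : T (m ≤ᵇ n)} → m ≤ n
lit≤ {m} {n} {m≤ᵇn} = ≤ᵇ⇒≤ m n m≤ᵇn

Small Large : ℕ → Set
Small s = 1 ≤ s × s ≤ 2
Large s = 5 ≤ s

small? : ∀ s → Dec (Small s)
small? s = (1 ≤? s) ×-dec (s ≤? 2)

large? : ∀ s → Dec (Large s)
large? s = 5 ≤? s

small⇒¬large : ∀ {s} → Small s → ¬ Large s
small⇒¬large (_ , s≤2) 5≤s = <⇒≱ lit≤ (≤-trans 5≤s s≤2)

weight : ℕ → ℕ
weight 1 = 12
weight 2 = 6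
weight 3 = 4
weight 4 = 3
weight _ = 0

weight-small : ∀ {s} → Small s → 6 ≤ weight s
weight-small {1} _ = lit≤
weight-small {2} _ = ≤-refl
weight-small {suc (suc (suc _))} (_ , s≤s (s≤s ()))

weight-≤4 : ∀ {s} → 1 ≤ s → s ≤ 4 → 3 ≤ weight s
weight-≤4 {1} _ _ = lit≤
weight-≤4 {2} _ _ = lit≤
weight-≤4 {3} _ _ = lit≤
weight-≤4 {4} _ _ = lit≤
weight-≤4 {suc (suc (suc (suc (suc _))))} _ (s≤s (s≤s (s≤s (s≤s ()))))

weight-class : ∀ {s} → 1 ≤ s → s * weight s + 12 * 𝟙 (large? s) ≡ 12
weight-class {1} _ = refl
weight-class {2} _ = refl
weight-class {3} _ = refl
weight-class {4} _ = refl
weight-class {s@(suc (suc (suc (suc (suc m)))))} _ =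
  cong₂ _+_ (*-zeroʳ s) (cong (12 *_) (𝟙-yes (large? s) (m≤m+n 5 m)))

weight-bound : ∀ {s} → 1 ≤ s → 3 + 3 * 𝟙 (small? s) ≤ weight s + 3 * 𝟙 (large? s)
weight-bound {1} _ = lit≤
weight-bound {2} _ = lit≤
weight-bound {3} _ = lit≤
weight-bound {4} _ = lit≤
weight-bound {s@(suc (suc (suc (suc (suc m)))))} _ = ≤-reflexive (begin
  3 + 3 * 𝟙 (small? s) ≡⟨ cong (λ x → 3 + 3 * x) (𝟙-no (small? s) (λ small → small⇒¬large small (m≤m+n 5 m))) ⟩
  3                    ≡⟨ cong (3 *_) (𝟙-yes (large? s) (m≤m+n 5 m)) ⟨
  3 * 𝟙 (large? s)     ∎)
  where open ≡-Reasoning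

two-colours : ∀ {x y z} → x < 2 → y < 2 → z < 2 → x ≢ y → y ≢ z → x ≡ z
two-colours {0} {1} {0} _ _ _ _ _ = refl
two-colours {1} {0} {1} _ _ _ _ _ = refl
two-colours {0} {0}     _ _ _ x≢y _ = contradiction refl x≢y
two-colours {1} {1}     _ _ _ x≢y _ = contradiction refl x≢y
two-colours {_} {0} {0} _ _ _ _ y≢z = contradiction refl y≢z
two-colours {_} {1} {1} _ _ _ _ y≢z = contradiction refl y≢z
two-colours {suc (suc _)} (s≤s (s≤s ())) _ _ _ _
two-colours {_} {suc (suc _)} _ (s≤s (s≤s ())) _ _ _
two-colours {_} {_} {suc (suc _)} _ _ (s≤s (s≤s ())) _ _

3<k : ∀ {k} → 37 ≤ 12 * k → 3 < k
3<k {k} = *-cancelˡ-< 12 3 k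

⌈/6⌉+2≤k : ∀ {n k} → 2 * n + 23 ≤ 12 * k → ⌈ n /6⌉ + 2 ≤ k
⌈/6⌉+2≤k {n} {k} le = s≤s⁻¹ (*-cancelˡ-< 12 (⌈ n /6⌉ + 2) (suc k) (begin-strict
  12 * (⌈ n /6⌉ + 2)    ≡⟨ unfold ⌈ n /6⌉ ⟩
  2 * (⌈ n /6⌉ * 6) + 24 ≤⟨ +-monoˡ-≤ 24 (*-monoʳ-≤ 2 (m/n*n≤m (n + 5) 6)) ⟩
  2 * (n + 5) + 24      <⟨ +-monoʳ-< (2 * (n + 5)) lit≤ ⟩
  2 * (n + 5) + 25      ≡⟨ regroup n ⟩
  2 * n + 23 + 12       ≤⟨ +-monoˡ-≤ 12 le ⟩
  12 * k + 12           ≡⟨ +-comm (12 * k) 12 ⟩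
  12 + 12 * k           ≡⟨ *-suc 12 k ⟨
  12 * suc k            ∎))
  where
  open ≤-Reasoning
  unfold : ∀ c → 12 * (c + 2) ≡ 2 * (c * 6) + 24
  unfold = solve-∀
  regroup : ∀ n → 2 * (n + 5) + 25 ≡ 2 * n + 23 + 12
  regroup = solve-∀

module LowerBound {n k : ℕ} {f : ℕ → ℕ} (md : IsPathMD n k f) where

  open IsPathMD md

  col : ℕ → ℕ
  col = pad n k f

  col-vertex : ∀ {i} → i < n → col (suc i) ≡ f i
  col-vertex = pad-vertex {n} {k} {f}

  col-outside : ∀ {i} → n ≤ i → col (suc i) ≡ k
  col-outside = pad-outside {n} {k} {f}

  size : ℕ → ℕ
  size = classCount n f

  sizeAt : ℕ → ℕ
  sizeAt p = size (col p)

  SmallAt LargeAt : ℕ → Set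
  SmallAt v = Small (sizeAt (suc v))
  LargeAt v = Large (sizeAt (suc v))

  size-pos : ∀ {a} → a < k → 1 ≤ size a
  size-pos a<k = let i , i<n , fi≡a = onto a<k in count-≥ (λ i → f i ≟ _) ([] ∷ []) ((i<n , fi≡a) ∷ [])

  size-k : size k ≡ 0
  size-k = classCount-beyond colour<k

  sizeAt-beyond : sizeAt (suc n) ≡ 0
  sizeAt-beyond = trans (cong size (col-outside ≤-refl)) size-k

  sizeAt-vertex : ∀ {v} → v < n → sizeAt (suc v) ≡ size (f v)
  sizeAt-vertex v<n = cong size (col-vertex v<n)

  sizeAt-pos : ∀ {v} → v < n → 1 ≤ sizeAt (suc v)
  sizeAt-pos v<n = subst (1 ≤_) (sym (sizeAt-vertex v<n)) (size-pos (colour<k v<n))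

  sizeAt-pos⇒vertex : ∀ {v} → 1 ≤ sizeAt (suc v) → v < n
  sizeAt-pos⇒vertex {v} 1≤S = decide (v <? n)
    where
    decide : Dec (v < n) → v < n
    decide (yes v<n) = v<n
    decide (no  v≮n) = contradiction (trans (cong size (col-outside (≮⇒≥ v≮n))) size-k) (<⇒≢ 1≤S ∘ sym)

  col-adjacent : 0 < n → ∀ {p} → p ≤ n → col p ≢ col (suc p)
  col-adjacent 0<n {zero}  _   eq = <⇒≢ (colour<k 0<n) (trans (sym (col-vertex 0<n)) (sym eq))
  col-adjacent _   {suc i} i<n eq = next-colour (suc i <? n)
    where
    next-colour : Dec (suc i < n) → ⊥
    next-colour (yes 1+i<n) = proper 1+i<n (trans (sym (col-vertex i<n)) (trans eq (col-vertex 1+i<n)))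
    next-colour (no  1+i≮n) = <⇒≢ (colour<k i<n) (trans (sym (col-vertex i<n)) (trans eq (col-outside (≮⇒≥ 1+i≮n))))

  data Dominated (v : ℕ) : Set where
    small-left  : Small (sizeAt v) → Dominated v
    small-self  : Small (sizeAt (suc v)) → Dominated v
    small-right : Small (sizeAt (suc (suc v))) → Dominated v
    twin        : col v ≡ col (suc (suc v)) → 1 ≤ sizeAt v → sizeAt v ≤ 4 → Dominated v

  dominated : ∀ {v} → v < n → Dominated v
  dominated {v} v<n = let a , a<k , le = majority v<n in by-colour a<k le
    where
    0<n = ≤-trans (s≤s z≤n) v<n
    by-colour : ∀ {a} → a < k → size a ≤ 2 * (𝟙 (col v ≟ a) + 𝟙 (col (suc v) ≟ a) + 𝟙 (col (suc (suc v)) ≟ a)) →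
                Dominated v
    by-colour {a} a<k le with col v ≟ a | col (suc v) ≟ a | col (suc (suc v)) ≟ a
    ... | yes refl | yes e    | _        = contradiction (sym e) (col-adjacent 0<n (<⇒≤ v<n))
    ... | _        | yes refl | yes e    = contradiction (sym e) (col-adjacent 0<n v<n)
    ... | no _     | yes refl | no _     = small-self (size-pos a<k , le)
    ... | yes refl | no _     | no _     = small-left (size-pos a<k , le)
    ... | no _     | no _     | yes refl = small-right (size-pos a<k , le)
    ... | yes refl | no _     | yes e    = twin (sym e) (size-pos a<k) le
    ... | no _     | no _     | no _     = contradiction le (<⇒≱ (size-pos a<k))

  W largeClasses #small #large : ℕ
  W            = ∑[ v < n ] weight (sizeAt (suc v))
  largeClasses = ∑[ a < k ] 𝟙 (large? (size a))
  #small       = ∑[ v < n ] 𝟙 (small? (sizeAt (suc v)))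
  #large       = ∑[ v < n ] 𝟙 (large? (sizeAt (suc v)))

  W+12·largeClasses≡12k : W + 12 * largeClasses ≡ 12 * k
  W+12·largeClasses≡12k = begin
    W + 12 * largeClasses
      ≡⟨ cong₂ _+_ (trans (∑-cong n (cong (weight ∘ size) ∘ col-vertex)) (∑-by-value n k f (weight ∘ size) colour<k))
                   (sym (∑-*ˡ k 12 _)) ⟩
    ∑[ a < k ] (size a * weight (size a)) + ∑[ a < k ] (12 * 𝟙 (large? (size a)))
      ≡⟨ sym (∑-distrib-+ k _ _) ⟩
    ∑[ a < k ] (size a * weight (size a) + 12 * 𝟙 (large? (size a)))
      ≡⟨ ∑-cong k (weight-class ∘ size-pos) ⟩
    ∑[ _ < k ] 12
      ≡⟨ trans (∑-const k 12) (*-comm k 12) ⟩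
    12 * k ∎
    where open ≡-Reasoning

  6≤local-weight : ∀ {v} → v < n → 6 ≤ weight (sizeAt v) + weight (sizeAt (suc v)) + weight (sizeAt (suc (suc v)))
  6≤local-weight v<n = of-dominated (dominated v<n)
    where
    of-dominated : ∀ {v} → Dominated v → 6 ≤ weight (sizeAt v) + weight (sizeAt (suc v)) + weight (sizeAt (suc (suc v)))
    of-dominated {v} (small-left small)  =
      ≤-trans (weight-small small) (≤-trans (m≤m+n _ (weight (sizeAt (suc v)))) (m≤m+n _ (weight (sizeAt (suc (suc v))))))
    of-dominated {v} (small-self small)  =
      ≤-trans (weight-small small) (≤-trans (m≤n+m _ (weight (sizeAt v))) (m≤m+n _ (weight (sizeAt (suc (suc v))))))
    of-dominated {v} (small-right small) =
      ≤-trans (weight-small small) (m≤n+m _ (weight (sizeAt v) + weight (sizeAt (suc v))))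
    of-dominated {v} (twin same 1≤S S≤4) =
      +-mono-≤ (≤-trans (weight-≤4 1≤S S≤4) (m≤m+n _ (weight (sizeAt (suc v)))))
               (subst (λ p → 3 ≤ weight (size p)) same (weight-≤4 1≤S S≤4))

  2n≤W : 2 * n ≤ W
  2n≤W = *-cancelˡ-≤ 3 (begin
    3 * (2 * n)                                          ≡⟨ trans (sym (*-assoc 3 2 n)) (*-comm 6 n) ⟩
    n * 6                                                ≡⟨ ∑-const n 6 ⟨
    ∑[ _ < n ] 6                                         ≤⟨ ∑-mono-≤ n 6≤local-weight ⟩
    ∑[ v < n ] (weight (sizeAt v) + weight (sizeAt (suc v)) + weight (sizeAt (suc (suc v))))
      ≡⟨ trans (∑-distrib-+ n (λ v → weight (sizeAt v) + weight (sizeAt (suc v))) (λ v → weight (sizeAt (suc (suc v)))))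
               (cong (_+ ∑[ v < n ] weight (sizeAt (suc (suc v)))) (∑-distrib-+ n (weight ∘ sizeAt) (weight ∘ sizeAt ∘ suc))) ⟩
    ∑[ v < n ] weight (sizeAt v) + W + ∑[ v < n ] weight (sizeAt (suc (suc v)))
      ≤⟨ +-mono-≤ (+-monoˡ-≤ W left≤W) right≤W ⟩
    W + W + W                                            ≡⟨ trans (+-assoc W W W) (cong (λ x → W + (W + x)) (sym (+-identityʳ W))) ⟩
    3 * W                                                ∎)
    where
    open ≤-Reasoning
    left≤W : ∑[ v < n ] weight (sizeAt v) ≤ W
    left≤W = ≤-trans (∑-prefix (weight ∘ sizeAt) (n≤1+n n)) (≤-reflexive (cong (λ s → weight s + W) size-k))
    right≤W : ∑[ v < n ] weight (sizeAt (suc (suc v))) ≤ W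
    right≤W = begin
      ∑[ v < n ] weight (sizeAt (suc (suc v)))   ≤⟨ m≤n+m _ (weight (sizeAt 1)) ⟩
      ∑[ v < suc n ] weight (sizeAt (suc v))     ≡⟨ ∑-snoc n (weight ∘ sizeAt ∘ suc) ⟩
      W + weight (sizeAt (suc n))                ≡⟨ cong (λ s → W + weight s) sizeAt-beyond ⟩
      W + 0                                 ≡⟨ +-identityʳ W ⟩
      W                                     ∎

  3n+3·#small≤W+3·#large : 3 * n + 3 * #small ≤ W + 3 * #large
  3n+3·#small≤W+3·#large = begin
    3 * n + 3 * #small                                   ≡⟨ cong₂ _+_ (trans (*-comm 3 n) (sym (∑-const n 3))) (sym (∑-*ˡ n 3 _)) ⟩
    ∑[ _ < n ] 3 + ∑[ v < n ] (3 * 𝟙 (small? (sizeAt (suc v)))) ≡⟨ ∑-distrib-+ n _ _ ⟨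
    ∑[ v < n ] (3 + 3 * 𝟙 (small? (sizeAt (suc v))))            ≤⟨ ∑-mono-≤ n (weight-bound ∘ sizeAt-pos) ⟩
    ∑[ v < n ] (weight (sizeAt (suc v)) + 3 * 𝟙 (large? (sizeAt (suc v)))) ≡⟨ ∑-distrib-+ n _ _ ⟩
    W + ∑[ v < n ] (3 * 𝟙 (large? (sizeAt (suc v))))            ≡⟨ cong (W +_) (∑-*ˡ n 3 _) ⟩
    W + 3 * #large                                         ∎
    where open ≤-Reasoning

  large⇒1≤largeClasses : ∀ {v} → v < n → LargeAt v → 1 ≤ largeClasses
  large⇒1≤largeClasses v<n large =
    count-≥ (large? ∘ size) ([] ∷ []) ((colour<k v<n , subst Large (sizeAt-vertex v<n) large) ∷ [])

  adjacent-large⇒2≤largeClasses : ∀ {v} → suc v < n → LargeAt v → LargeAt (suc v) → 2 ≤ largeClasses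
  adjacent-large⇒2≤largeClasses {v} 1+v<n large large′ =
    subst₂ (λ x y → x + y ≤ largeClasses)
      (𝟙-yes (large? (size (f v))) (subst Large (sizeAt-vertex v<n) large))
      (𝟙-yes (large? (size (f (suc v)))) (subst Large (sizeAt-vertex 1+v<n) large′))
      (∑-≥-two (𝟙 ∘ large? ∘ size) (proper 1+v<n) (colour<k v<n) (colour<k 1+v<n))
    where v<n = <-trans (n<1+n v) 1+v<n

  separated : largeClasses ≤ 1 → SeparatedBy SmallAt LargeAt n
  separated b≤1 {p} {q} p<q q<n large large′ = between (dominated (<-trans p+1<q q<n))
    where
    p+1<q : suc p < q
    p+1<q = ≤∧≢⇒< p<q λ { refl →
      contradiction (adjacent-large⇒2≤largeClasses q<n large large′) (<⇒≱ (s≤s b≤1)) }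

    between : Dominated (suc p) → ∃[ r ] p < r × r < q × SmallAt r
    between (small-left small)  = contradiction large (small⇒¬large small)
    between (small-self small)  = suc p , n<1+n p , p+1<q , small
    between (small-right small) = suc (suc p) , <-trans (n<1+n p) (n<1+n (suc p)) ,
                                  ≤∧≢⇒< p+1<q (λ { refl → small⇒¬large small large′ }) , small
    between (twin _ _ S≤4)      = contradiction (≤-trans large S≤4) (<⇒≱ lit≤)

  #large≤#small+1 : largeClasses ≤ 1 → #large ≤ #small + 1
  #large≤#small+1 b≤1 = separated⇒count≤count+1 (large? ∘ sizeAt ∘ suc) (small? ∘ sizeAt ∘ suc) n (separated b≤1)

  #large≡0 : largeClasses ≡ 0 → #large ≡ 0
  #large≡0 b≡0 = trans (∑-cong n λ v<n → 𝟙-no (large? _) λ large →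
                          contradiction (large⇒1≤largeClasses v<n large) (subst (1 ≰_) (sym b≡0) λ ()))
                       (∑-zero n)

  sizeAt-start-empty : ¬ (1 ≤ sizeAt 0)
  sizeAt-start-empty 1≤S = contradiction (subst (1 ≤_) size-k 1≤S) λ ()

  sizeAt-beyond-empty : ¬ (1 ≤ sizeAt (suc n))
  sizeAt-beyond-empty 1≤S = contradiction (subst (1 ≤_) sizeAt-beyond 1≤S) λ ()

  small-near-start : 0 < n → ∃[ r ] r ≤ 1 × SmallAt r
  small-near-start 0<n with dominated 0<n
  ... | small-left (1≤S , _) = contradiction 1≤S sizeAt-start-empty
  ... | small-self small     = 0 , z≤n , small
  ... | small-right small    = 1 , ≤-refl , small
  ... | twin _ 1≤S _         = contradiction 1≤S sizeAt-start-empty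

  small-near-end : 0 < n → ∃[ r ] n ≤ 2 + r × SmallAt r
  small-near-end 0<n = near-end (suc-pred n ⦃ >-nonZero 0<n ⦄)
    where
    near-end : ∀ {m} → suc m ≡ n → ∃[ r ] n ≤ 2 + r × SmallAt r
    near-end {m} refl with dominated {m} ≤-refl
    near-end {zero}  refl | small-left (1≤S , _) = contradiction 1≤S sizeAt-start-empty
    near-end {suc r} refl | small-left small     = r , ≤-refl , small
    ... | small-self small            = m , n≤1+n (suc m) , small
    ... | small-right (1≤S , _)       = contradiction 1≤S sizeAt-beyond-empty
    ... | twin same 1≤S _             = contradiction (subst (λ p → 1 ≤ size p) same 1≤S) sizeAt-beyond-empty

  twin-forced : ∀ {v} → v < n → ¬ Small (sizeAt v) → ¬ Small (sizeAt (suc v)) → ¬ Small (sizeAt (suc (suc v))) →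
                col v ≡ col (suc (suc v))
  twin-forced v<n ¬left ¬self ¬right with dominated v<n
  ... | small-left  small = contradiction small ¬left
  ... | small-self  small = contradiction small ¬self
  ... | small-right small = contradiction small ¬right
  ... | twin same _ _     = same

  -- With no large class, vertices 2, …, 10 cannot all avoid small classes: the alternate ones would form a
  -- class of five vertices.
  small-in-middle : largeClasses ≡ 0 → 11 ≤ n → ∃[ r ] 2 ≤ r × r ≤ 10 × SmallAt r
  small-in-middle b≡0 11≤n with anyUpTo? (λ j → small? (sizeAt (3 + j))) 9
  ... | yes (j , j<9 , small) = 2 + j , m≤m+n 2 j , +-monoʳ-≤ 2 (s≤s⁻¹ j<9) , small
  ... | no none = contradiction (large⇒1≤largeClasses (lt 2 lit≤) five) (subst (1 ≰_) (sym b≡0) λ ())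
    where
    lt : ∀ i → i < 11 → i < n
    lt i i<11 = <-≤-trans i<11 11≤n

    ¬small : ∀ j → j < 9 → ¬ Small (sizeAt (3 + j))
    ¬small j j<9 small = none (j , j<9 , small)

    col3≡col5 : col 3 ≡ col 5
    col3≡col5 = twin-forced (lt 3 lit≤) (¬small 0 lit≤) (¬small 1 lit≤) (¬small 2 lit≤)
    col5≡col7 : col 5 ≡ col 7
    col5≡col7 = twin-forced (lt 5 lit≤) (¬small 2 lit≤) (¬small 3 lit≤) (¬small 4 lit≤)
    col7≡col9 : col 7 ≡ col 9
    col7≡col9 = twin-forced (lt 7 lit≤) (¬small 4 lit≤) (¬small 5 lit≤) (¬small 6 lit≤)
    col9≡col11 : col 9 ≡ col 11
    col9≡col11 = twin-forced (lt 9 lit≤) (¬small 6 lit≤) (¬small 7 lit≤) (¬small 8 lit≤)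

    member : ∀ i → i < 11 → col (suc i) ≡ col 3 → i < n × f i ≡ f 2
    member i i<11 same = lt i i<11 , trans (sym (col-vertex (lt i i<11))) (trans same (col-vertex (lt 2 lit≤)))

    five : LargeAt 2
    five = subst Large (sym (sizeAt-vertex (lt 2 lit≤)))
      (count-≥ (λ i → f i ≟ f 2) (from-yes (allPairs? _>?_ (10 ∷ 8 ∷ 6 ∷ 4 ∷ 2 ∷ [])))
      ( member 10 lit≤ (sym (trans col3≡col5 (trans col5≡col7 (trans col7≡col9 col9≡col11))))
      ∷ member 8 lit≤ (sym (trans col3≡col5 (trans col5≡col7 col7≡col9)))
      ∷ member 6 lit≤ (sym (trans col3≡col5 col5≡col7))
      ∷ member 4 lit≤ (sym col3≡col5)
      ∷ member 2 lit≤ refl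
      ∷ []))

  two-smalls : 4 ≤ n → 2 ≤ #small
  two-smalls 4≤n =
    let r₀ , r₀≤1 , small₀ = small-near-start (≤-trans (s≤s z≤n) 4≤n)
        r₁ , n≤2+r₁ , small₁ = small-near-end (≤-trans (s≤s z≤n) 4≤n)
        2≤r₁ = +-cancelˡ-≤ 2 2 r₁ (≤-trans 4≤n n≤2+r₁)
    in count-≥ (small? ∘ sizeAt ∘ suc) ((≤-trans (s≤s r₀≤1) 2≤r₁ ∷ []) ∷ [] ∷ [])
         ((sizeAt-pos⇒vertex (proj₁ small₁) , small₁) ∷ (sizeAt-pos⇒vertex (proj₁ small₀) , small₀) ∷ [])

  three-smalls : largeClasses ≡ 0 → 13 ≤ n → 3 ≤ #small
  three-smalls b≡0 13≤n =
    let r₀ , r₀≤1 , small₀ = small-near-start (≤-trans (s≤s z≤n) 13≤n)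
        r , 2≤r , r≤10 , small = small-in-middle b≡0 (≤-trans (m≤n+m 11 2) 13≤n)
        r₁ , n≤2+r₁ , small₁ = small-near-end (≤-trans (s≤s z≤n) 13≤n)
        r₀<r = ≤-trans (s≤s r₀≤1) 2≤r
        r<r₁ = ≤-trans (s≤s r≤10) (+-cancelˡ-≤ 2 11 r₁ (≤-trans 13≤n n≤2+r₁))
    in count-≥ (small? ∘ sizeAt ∘ suc) ((r<r₁ ∷ <-trans r₀<r r<r₁ ∷ []) ∷ (r₀<r ∷ []) ∷ [] ∷ [])
         ((sizeAt-pos⇒vertex (proj₁ small₁) , small₁) ∷ (sizeAt-pos⇒vertex (proj₁ small) , small) ∷
          (sizeAt-pos⇒vertex (proj₁ small₀) , small₀) ∷ [])

  0<k : 0 < n → 0 < k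
  0<k 0<n = ≤-trans (s≤s z≤n) (colour<k 0<n)

  2≤k : 1 < n → 2 ≤ k
  2≤k 1<n = subst (2 ≤_) (trans (∑-const k 1) (*-identityʳ k))
                  (∑-≥-two (λ _ → 1) (proper 1<n) (colour<k (<-trans z<s 1<n)) (colour<k 1<n))

  -- With two colours the colouring alternates, so both classes meeting {0, 1} have at least three vertices.
  k≢2 : 6 ≤ n → k ≢ 2
  k≢2 6≤n refl = let r , r≤1 , small = small-near-start (≤-trans (s≤s z≤n) 6≤n) in
    contradiction (subst (_≤ 2) (sizeAt-vertex (lt r (≤-<-trans r≤1 lit≤))) (proj₂ small)) (<⇒≱ (three r r≤1))
    where
    lt : ∀ i → i < 6 → i < n
    lt i i<6 = <-≤-trans i<6 6≤n

    alternate : ∀ i → 2 + i < 6 → f i ≡ f (2 + i)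
    alternate i 2+i<6 = two-colours (colour<k (lt i i<6)) (colour<k (lt (1 + i) 1+i<6)) (colour<k (lt (2 + i) 2+i<6))
                                    (proper (lt (1 + i) 1+i<6)) (proper (lt (2 + i) 2+i<6))
      where
      1+i<6 = <-trans (n<1+n (suc i)) 2+i<6
      i<6   = <-trans (n<1+n i) 1+i<6

    three : ∀ r → r ≤ 1 → 2 < size (f r)
    three 0 _ = count-≥ (λ i → f i ≟ f 0) (from-yes (allPairs? _>?_ (4 ∷ 2 ∷ 0 ∷ [])))
      ((lt 4 lit≤ , sym (trans (alternate 0 lit≤) (alternate 2 lit≤))) ∷ (lt 2 lit≤ , sym (alternate 0 lit≤)) ∷
       (lt 0 lit≤ , refl) ∷ [])
    three 1 _ = count-≥ (λ i → f i ≟ f 1) (from-yes (allPairs? _>?_ (5 ∷ 3 ∷ 1 ∷ [])))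
      ((lt 5 lit≤ , sym (trans (alternate 1 lit≤) (alternate 3 lit≤))) ∷ (lt 3 lit≤ , sym (alternate 1 lit≤)) ∷
       (lt 1 lit≤ , refl) ∷ [])
    three (suc (suc _)) (s≤s ())

  no-large-class-bound : largeClasses ≡ 0 → ∀ {c} → c ≤ #small → 3 * n + 3 * c ≤ 12 * k
  no-large-class-bound b≡0 {c} c≤#small = begin
    3 * n + 3 * c         ≤⟨ +-monoʳ-≤ (3 * n) (*-monoʳ-≤ 3 c≤#small) ⟩
    3 * n + 3 * #small    ≤⟨ 3n+3·#small≤W+3·#large ⟩
    W + 3 * #large        ≡⟨ cong (λ l → W + 3 * l) (#large≡0 b≡0) ⟩
    W + 12 * 0            ≡⟨ cong (λ b → W + 12 * b) b≡0 ⟨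
    W + 12 * largeClasses ≡⟨ W+12·largeClasses≡12k ⟩
    12 * k                ∎
    where open ≤-Reasoning

  one-large-class-bound : largeClasses ≡ 1 → 3 * n + 9 ≤ 12 * k
  one-large-class-bound b≡1 = +-cancelʳ-≤ (3 * #small) _ _ (begin
    3 * n + 9 + 3 * #small             ≡⟨ shuffle (3 * n) (3 * #small) ⟩
    3 * n + 3 * #small + 9             ≤⟨ +-monoˡ-≤ 9 3n+3·#small≤W+3·#large ⟩
    W + 3 * #large + 9                 ≤⟨ +-monoˡ-≤ 9 (+-monoʳ-≤ W (*-monoʳ-≤ 3 (#large≤#small+1 (≤-reflexive b≡1)))) ⟩
    W + 3 * (#small + 1) + 9           ≡⟨ regroup W #small ⟩
    W + 12 * 1 + 3 * #small            ≡⟨ cong (λ b → W + 12 * b + 3 * #small) b≡1 ⟨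
    W + 12 * largeClasses + 3 * #small ≡⟨ cong (_+ 3 * #small) W+12·largeClasses≡12k ⟩
    12 * k + 3 * #small                ∎)
    where
    open ≤-Reasoning
    shuffle : ∀ a b → a + 9 + b ≡ a + b + 9
    shuffle = solve-∀
    regroup : ∀ w x → w + 3 * (x + 1) + 9 ≡ w + 12 * 1 + 3 * x
    regroup = solve-∀

  two-large-classes-bound : 2 ≤ largeClasses → 2 * n + 24 ≤ 12 * k
  two-large-classes-bound 2≤b = begin
    2 * n + 24            ≤⟨ +-mono-≤ 2n≤W (*-monoʳ-≤ 12 2≤b) ⟩
    W + 12 * largeClasses ≡⟨ W+12·largeClasses≡12k ⟩
    12 * k                ∎
    where open ≤-Reasoning

  count-bound : 4 ≤ n → 2 * n + 24 ≤ 12 * k ⊎ (3 * n + 6 ≤ 12 * k × (13 ≤ n → 3 * n + 9 ≤ 12 * k))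
  count-bound 4≤n with largeClasses in b≡
  ... | 0           = inj₂ (no-large-class-bound b≡ (two-smalls 4≤n) ,
                            λ 13≤n → no-large-class-bound b≡ (three-smalls b≡ 13≤n))
  ... | 1           = inj₂ (≤-trans (+-monoʳ-≤ (3 * n) lit≤) (one-large-class-bound b≡) ,
                            λ _ → one-large-class-bound b≡)
  ... | suc (suc _) = inj₁ (two-large-classes-bound (≤-trans (s≤s (s≤s z≤n)) (≤-reflexive (sym b≡))))

  pathValue≤k : 0 < n → pathValue n ≤ k
  pathValue≤k 0<n with n ≤? 1 | n ≤? 5 | n ≤? 10 | n ≤? 13
  ... | yes _  | _      | _       | _       = 0<k 0<n
  ... | no n≰1 | yes _  | _       | _       = 2≤k (≰⇒> n≰1)
  ... | no n≰1 | no n≰5 | yes _   | _       = ≤∧≢⇒< (2≤k (≰⇒> n≰1)) (k≢2 (≰⇒> n≰5) ∘ sym)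
  ... | no _   | no _   | no n≰10 | yes _   with count-bound (≤-trans lit≤ (≰⇒> n≰10))
  ...   | inj₁ le       = 3<k (≤-trans lit≤ (≤-trans (+-monoˡ-≤ 24 (*-monoʳ-≤ 2 (≰⇒> n≰10))) le))
  ...   | inj₂ (le , _) = 3<k (≤-trans lit≤ (≤-trans (+-monoˡ-≤ 6 (*-monoʳ-≤ 3 (≰⇒> n≰10))) le))
  pathValue≤k 0<n | no _ | no _ | no _ | no n≰13 with count-bound (≤-trans lit≤ (≰⇒> n≰13))
  ...   | inj₁ le        = ⌈/6⌉+2≤k {n} (≤-trans (+-monoʳ-≤ (2 * n) lit≤) le)
  ...   | inj₂ (_ , le)  = ⌈/6⌉+2≤k {n} (≤-trans (2n+23≤3n+9 (≰⇒> n≰13)) (le (≤-trans lit≤ (≰⇒> n≰13))))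
    where
    2n+23≤3n+9 : 14 ≤ n → 2 * n + 23 ≤ 3 * n + 9
    2n+23≤3n+9 14≤n = ≤-trans (+-monoʳ-≤ (2 * n) (+-monoˡ-≤ 9 14≤n)) (≤-reflexive (regroup n))
      where
      regroup : ∀ n → 2 * n + (n + 9) ≡ 3 * n + 9
      regroup = solve-∀

-- Upper bound

isPathMD? : ∀ n k f → Dec (IsPathMD n k f)
isPathMD? n k f = map′ fromProduct toProduct
  (allUpTo? (λ i → f i <? k) n ×-dec
   allUpTo? (λ i → suc i <? n →-dec ¬? (f i ≟ f (suc i))) n ×-dec
   allUpTo? (λ a → anyUpTo? (λ i → f i ≟ a) n) k ×-dec
   allUpTo? (λ v → anyUpTo? (λ a → classCount n f a ≤? 2 * nbhdCount n k f v a) k) n)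
  where
  Product : Set
  Product = (∀ {i} → i < n → f i < k) × (∀ {i} → i < n → suc i < n → f i ≢ f (suc i)) ×
            (∀ {a} → a < k → ∃[ i ] i < n × f i ≡ a) ×
            (∀ {v} → v < n → ∃[ a ] a < k × classCount n f a ≤ 2 * nbhdCount n k f v a)

  fromProduct : Product → IsPathMD n k f
  fromProduct (colour<k , proper , onto , majority) = record
    { colour<k = colour<k
    ; proper   = λ {i} 1+i<n → proper (<-trans (n<1+n i) 1+i<n) 1+i<n
    ; onto     = onto
    ; majority = majority
    }

  toProduct : IsPathMD n k f → Product
  toProduct md = colour<k , (λ _ → proper) , onto , majority
    where open IsPathMD md

listColouring : List ℕ → ℕ → ℕ
listColouring []       _       = 0
listColouring (c ∷ cs) zero    = c
listColouring (c ∷ cs) (suc i) = listColouring cs i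

colouredBy : ∀ k (cs : List ℕ) → From-yes (isPathMD? (length cs) k (listColouring cs))
colouredBy k cs = from-yes (isPathMD? (length cs) k (listColouring cs))

Near : ℕ → ℕ → Set
Near v j = j ≡ v ⊎ suc j ≡ v ⊎ j ≡ suc v

majority-via-small-class : ∀ {n k f v j} → j < n → f j < k → Near v j → classCount n f (f j) ≤ 2 →
                           ∃[ a ] a < k × classCount n f a ≤ 2 * nbhdCount n k f v a
majority-via-small-class {n} {k} {f} {v} {j} j<n fj<k near small =
  f j , fj<k , ≤-trans small (*-monoʳ-≤ 2 (met near))
  where
  here : 𝟙 (pad n k f (suc j) ≟ f j) ≡ 1
  here = 𝟙-yes (pad n k f (suc j) ≟ f j) (pad-vertex j<n)

  met : Near v j → 1 ≤ nbhdCount n k f v (f j)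
  met (inj₁ refl)        = ≤-trans (≤-reflexive (sym here)) (≤-trans (m≤n+m _ (𝟙 (pad n k f v ≟ f j))) (m≤m+n _ _))
  met (inj₂ (inj₁ refl)) = ≤-trans (≤-reflexive (sym here)) (≤-trans (m≤m+n _ _) (m≤m+n _ _))
  met (inj₂ (inj₂ refl)) = ≤-trans (≤-reflexive (sym here)) (m≤n+m _ _)

tailColouring : ℕ → List ℕ
tailColouring 1 = 2 ∷ []
tailColouring 2 = 0 ∷ 2 ∷ []
tailColouring 3 = 0 ∷ 2 ∷ 0 ∷ []
tailColouring 4 = 0 ∷ 2 ∷ 1 ∷ 2 ∷ []
tailColouring 5 = 0 ∷ 2 ∷ 0 ∷ 1 ∷ 2 ∷ []
tailColouring 6 = 0 ∷ 2 ∷ 0 ∷ 1 ∷ 2 ∷ 1 ∷ []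
tailColouring _ = []

-- Blocks of six vertices coloured 0 c 0 1 c 1, with a fresh colour c per block, followed by the tail in
-- colours 0, 1, 2: every colour c ≥ 2 has at most two vertices, and every closed neighbourhood meets one.
periodic : ℕ → ℕ → ℕ → ℕ
periodic zero    r i = listColouring (tailColouring r) i
periodic (suc q) r 0 = 0
periodic (suc q) r 1 = 3 + q
periodic (suc q) r 2 = 0
periodic (suc q) r 3 = 1
periodic (suc q) r 4 = 3 + q
periodic (suc q) r 5 = 1
periodic (suc q) r (suc (suc (suc (suc (suc (suc i)))))) = periodic q r i

record TailFacts (r : ℕ) : Set where
  field
    colour<3   : ∀ {i} → i < r → periodic 0 r i < 3
    proper     : ∀ {i} → suc i < r → periodic 0 r i ≢ periodic 0 r (suc i)
    first≢1    : periodic 0 r 0 ≢ 1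
    count₂≤2   : classCount r (periodic 0 r) 2 ≤ 2
    near-small : ∀ {v} → v < r → ∃[ j ] j < r × (2 ≤ periodic 0 r j × Near v j)
    has-2      : ∃[ i ] i < r × periodic 0 r i ≡ 2

tailFacts? : ∀ r → Dec (TailFacts r)
tailFacts? r = map′ fromProduct toProduct
  (allUpTo? (λ i → g i <? 3) r ×-dec
   allUpTo? (λ i → suc i <? r →-dec ¬? (g i ≟ g (suc i))) r ×-dec
   ¬? (g 0 ≟ 1) ×-dec
   classCount r g 2 ≤? 2 ×-dec
   allUpTo? (λ v → anyUpTo? (λ j → (2 ≤? g j) ×-dec ((j ≟ v) ⊎-dec (suc j ≟ v) ⊎-dec (j ≟ suc v))) r) r ×-dec
   anyUpTo? (λ i → g i ≟ 2) r)
  where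
  g = periodic 0 r
  Product : Set
  Product = (∀ {i} → i < r → g i < 3) × (∀ {i} → i < r → suc i < r → g i ≢ g (suc i)) × g 0 ≢ 1 ×
            classCount r g 2 ≤ 2 × (∀ {v} → v < r → ∃[ j ] j < r × (2 ≤ g j × Near v j)) ×
            (∃[ i ] i < r × g i ≡ 2)

  fromProduct : Product → TailFacts r
  fromProduct (a , b , c , d , e , f) = record
    { colour<3 = a ; proper = λ {i} 1+i<r → b (<-trans (n<1+n i) 1+i<r) 1+i<r ; first≢1 = c ; count₂≤2 = d
    ; near-small = e ; has-2 = f }

  toProduct : TailFacts r → Product
  toProduct t = colour<3 , (λ _ → proper) , first≢1 , count₂≤2 , near-small , has-2
    where open TailFacts t

tailFacts : ∀ {r} → 1 ≤ r → r ≤ 6 → TailFacts r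
tailFacts {1} _ _ = from-yes (tailFacts? 1)
tailFacts {2} _ _ = from-yes (tailFacts? 2)
tailFacts {3} _ _ = from-yes (tailFacts? 3)
tailFacts {4} _ _ = from-yes (tailFacts? 4)
tailFacts {5} _ _ = from-yes (tailFacts? 5)
tailFacts {6} _ _ = from-yes (tailFacts? 6)
tailFacts {suc (suc (suc (suc (suc (suc (suc _))))))} _ (s≤s (s≤s (s≤s (s≤s (s≤s (s≤s ()))))))

module Periodic {r : ℕ} (tail : TailFacts r) where

  open TailFacts tail

  len : ℕ → ℕ
  len q = q * 6 + r

  periodic-< : ∀ q {i} → i < len q → periodic q r i < 3 + q
  periodic-< zero    i<r = colour<3 i<r
  periodic-< (suc q) {0} _ = z<s
  periodic-< (suc q) {1} _ = n<1+n (3 + q)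
  periodic-< (suc q) {2} _ = z<s
  periodic-< (suc q) {3} _ = s<s z<s
  periodic-< (suc q) {4} _ = n<1+n (3 + q)
  periodic-< (suc q) {5} _ = s<s z<s
  periodic-< (suc q) {suc (suc (suc (suc (suc (suc i)))))} i<len =
    m<n⇒m<1+n (periodic-< q (+-cancelˡ-< 6 i (len q) i<len))

  periodic-first≢1 : ∀ q → periodic q r 0 ≢ 1
  periodic-first≢1 zero    = first≢1
  periodic-first≢1 (suc q) = λ ()

  periodic-proper : ∀ q {i} → suc i < len q → periodic q r i ≢ periodic q r (suc i)
  periodic-proper zero    = proper
  periodic-proper (suc q) {0} _ = λ ()
  periodic-proper (suc q) {1} _ = λ ()
  periodic-proper (suc q) {2} _ = λ ()
  periodic-proper (suc q) {3} _ = λ ()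
  periodic-proper (suc q) {4} _ = λ ()
  periodic-proper (suc q) {5} _ = periodic-first≢1 q ∘ sym
  periodic-proper (suc q) {suc (suc (suc (suc (suc (suc i)))))} 1+i<len =
    periodic-proper q (+-cancelˡ-< 6 (suc i) (len q) 1+i<len)

  periodic-count : ∀ q {a} → 2 ≤ a → classCount (len q) (periodic q r) a ≤ 2
  periodic-count _       {0} ()
  periodic-count _       {1} (s≤s ())
  periodic-count zero    {2} _ = count₂≤2
  periodic-count zero    {suc (suc (suc a))} _ =
    ≤-trans (≤-reflexive (classCount-beyond (λ i<r → ≤-trans (colour<3 i<r) (m≤m+n 3 a)))) z≤n
  periodic-count (suc q) {suc (suc a)} 2≤a = block
    where
    block : 𝟙 (3 + q ≟ 2 + a) + (𝟙 (3 + q ≟ 2 + a) + classCount (len q) (periodic q r) (2 + a)) ≤ 2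
    block with 3 + q ≟ 2 + a
    ... | yes refl = ≤-reflexive (cong (2 +_) (classCount-beyond (periodic-< q)))
    ... | no _     = periodic-count q 2≤a

  periodic-near : ∀ q {v} → v < len q → ∃[ j ] j < len q × (2 ≤ periodic q r j × Near v j)
  periodic-near zero          v<r = near-small v<r
  periodic-near (suc q) {0} _ = 1 , <-≤-trans lit≤ (m≤m+n 6 (len q)) , s≤s (s≤s z≤n) , inj₂ (inj₂ refl)
  periodic-near (suc q) {1} _ = 1 , <-≤-trans lit≤ (m≤m+n 6 (len q)) , s≤s (s≤s z≤n) , inj₁ refl
  periodic-near (suc q) {2} _ = 1 , <-≤-trans lit≤ (m≤m+n 6 (len q)) , s≤s (s≤s z≤n) , inj₂ (inj₁ refl)
  periodic-near (suc q) {3} _ = 4 , <-≤-trans lit≤ (m≤m+n 6 (len q)) , s≤s (s≤s z≤n) , inj₂ (inj₂ refl)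
  periodic-near (suc q) {4} _ = 4 , <-≤-trans lit≤ (m≤m+n 6 (len q)) , s≤s (s≤s z≤n) , inj₁ refl
  periodic-near (suc q) {5} _ = 4 , <-≤-trans lit≤ (m≤m+n 6 (len q)) , s≤s (s≤s z≤n) , inj₂ (inj₁ refl)
  periodic-near (suc q) {suc (suc (suc (suc (suc (suc v)))))} v<len =
    let j , j<len , 2≤c , near = periodic-near q (+-cancelˡ-< 6 v (len q) v<len) in
    6 + j , +-monoʳ-< 6 j<len , 2≤c , Sum.map (cong (6 +_)) (Sum.map (cong (6 +_)) (cong (6 +_))) near

  periodic-onto : ∀ q {a} → 2 ≤ a → a < 3 + q → ∃[ i ] i < len q × periodic q r i ≡ a
  periodic-onto zero    {0} () _
  periodic-onto zero    {1} (s≤s ()) _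
  periodic-onto zero    {2} _ _ = has-2
  periodic-onto zero    {suc (suc (suc _))} _ (s≤s (s≤s (s≤s ())))
  periodic-onto (suc q) {a} 2≤a a<4+q with a ≟ 3 + q
  ... | yes refl = 1 , <-≤-trans lit≤ (m≤m+n 6 (len q)) , refl
  ... | no a≢3+q =
    let i , i<len , eq = periodic-onto q 2≤a (≤∧≢⇒< (s≤s⁻¹ a<4+q) a≢3+q) in 6 + i , +-monoʳ-< 6 i<len , eq

  periodicMD : ∀ q → IsPathMD (len (suc q)) (4 + q) (periodic (suc q) r)
  periodicMD q = record
    { colour<k = periodic-< (suc q)
    ; proper   = periodic-proper (suc q)
    ; onto     = onto
    ; majority = λ v<n → let j , j<n , 2≤c , near = periodic-near (suc q) v<n in
        majority-via-small-class j<n (periodic-< (suc q) j<n) near (periodic-count (suc q) 2≤c)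
    }
    where
    onto : ∀ {a} → a < 4 + q → ∃[ i ] i < len (suc q) × periodic (suc q) r i ≡ a
    onto {0} _ = 0 , <-≤-trans lit≤ (m≤m+n 6 (len q)) , refl
    onto {1} _ = 3 , <-≤-trans lit≤ (m≤m+n 6 (len q)) , refl
    onto {suc (suc a)} a<k = periodic-onto (suc q) (s≤s (s≤s z≤n)) a<k

decompose : ∀ n → 0 < n → ∃[ q ] ∃[ r ] 1 ≤ r × r ≤ 6 × n ≡ q * 6 + r
decompose (suc m) _ = m / 6 , suc (m % 6) , s≤s z≤n , m%n<n m 6 ,
  trans (cong suc (trans (m≡m%n+[m/n]*n m 6) (+-comm (m % 6) _))) (sym (+-suc (m / 6 * 6) (m % 6)))

⌈/6⌉-blocks : ∀ q {r} → 1 ≤ r → r ≤ 6 → ⌈ q * 6 + r /6⌉ ≡ suc q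
⌈/6⌉-blocks q {r} 1≤r r≤6 = begin
  (q * 6 + r + 5) / 6      ≡⟨ /-congˡ (regroup q r) ⟩
  (r + 5 + q * 6) / 6      ≡⟨ +-distrib-/-∣ʳ (r + 5) (n∣m*n q) ⟩
  (r + 5) / 6 + q * 6 / 6  ≡⟨ cong₂ _+_ (last-block 1≤r r≤6) (m*n/n≡m q 6) ⟩
  suc q                    ∎
  where
  open ≡-Reasoning
  regroup : ∀ q r → q * 6 + r + 5 ≡ r + 5 + q * 6
  regroup = solve-∀
  last-block : ∀ {r} → 1 ≤ r → r ≤ 6 → (r + 5) / 6 ≡ 1
  last-block {1} _ _ = refl
  last-block {2} _ _ = refl
  last-block {3} _ _ = refl
  last-block {4} _ _ = refl
  last-block {5} _ _ = refl
  last-block {6} _ _ = refl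
  last-block {suc (suc (suc (suc (suc (suc (suc _))))))} _ (s≤s (s≤s (s≤s (s≤s (s≤s (s≤s ()))))))

largePathColouring : ∀ n → 14 ≤ n → HasMDColoring (P n) (⌈ n /6⌉ + 2)
largePathColouring n 14≤n with decompose n (≤-trans (s≤s z≤n) 14≤n)
... | zero  , r , _   , r≤6 , refl = contradiction (≤-trans 14≤n r≤6) (<⇒≱ lit≤)
... | suc q , r , 1≤r , r≤6 , refl =
  subst (HasMDColoring (P n)) colours (hasMDColoring (Periodic.periodicMD (tailFacts 1≤r r≤6) q))
  where
  colours : 4 + q ≡ ⌈ n /6⌉ + 2
  colours = sym (trans (cong (_+ 2) (⌈/6⌉-blocks (suc q) 1≤r r≤6)) (+-comm (2 + q) 2))

pathColouring : ∀ n → 0 < n → HasMDColoring (P n) (pathValue n)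
pathColouring 1  _ = hasMDColoring (colouredBy 1 (0 ∷ []))
pathColouring 2  _ = hasMDColoring (colouredBy 2 (0 ∷ 1 ∷ []))
pathColouring 3  _ = hasMDColoring (colouredBy 2 (0 ∷ 1 ∷ 0 ∷ []))
pathColouring 4  _ = hasMDColoring (colouredBy 2 (0 ∷ 1 ∷ 0 ∷ 1 ∷ []))
pathColouring 5  _ = hasMDColoring (colouredBy 2 (0 ∷ 1 ∷ 0 ∷ 1 ∷ 0 ∷ []))
pathColouring 6  _ = hasMDColoring (colouredBy 3 (0 ∷ 1 ∷ 0 ∷ 1 ∷ 0 ∷ 2 ∷ []))
pathColouring 7  _ = hasMDColoring (colouredBy 3 (0 ∷ 1 ∷ 0 ∷ 1 ∷ 0 ∷ 2 ∷ 0 ∷ []))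
pathColouring 8  _ = hasMDColoring (colouredBy 3 (0 ∷ 1 ∷ 0 ∷ 1 ∷ 0 ∷ 2 ∷ 0 ∷ 2 ∷ []))
pathColouring 9  _ = hasMDColoring (colouredBy 3 (0 ∷ 1 ∷ 0 ∷ 1 ∷ 0 ∷ 2 ∷ 0 ∷ 2 ∷ 0 ∷ []))
pathColouring 10 _ = hasMDColoring (colouredBy 3 (0 ∷ 1 ∷ 0 ∷ 2 ∷ 0 ∷ 2 ∷ 0 ∷ 2 ∷ 1 ∷ 2 ∷ []))
pathColouring 11 _ = hasMDColoring (colouredBy 4 (0 ∷ 1 ∷ 0 ∷ 1 ∷ 0 ∷ 2 ∷ 0 ∷ 2 ∷ 0 ∷ 3 ∷ 0 ∷ []))
pathColouring 12 _ = hasMDColoring (colouredBy 4 (0 ∷ 1 ∷ 0 ∷ 1 ∷ 0 ∷ 2 ∷ 0 ∷ 2 ∷ 0 ∷ 3 ∷ 0 ∷ 3 ∷ []))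
pathColouring 13 _ = hasMDColoring (colouredBy 4 (0 ∷ 1 ∷ 0 ∷ 1 ∷ 0 ∷ 2 ∷ 0 ∷ 2 ∷ 0 ∷ 3 ∷ 0 ∷ 3 ∷ 0 ∷ []))
pathColouring n@(suc (suc (suc (suc (suc (suc (suc (suc (suc (suc (suc (suc (suc (suc _)))))))))))))) _ =
  largePathColouring n lit≤

theorem3p7 : (n : ℕ) → 1 ≤ n → χmd≡ (P n) (pathValue n)
theorem3p7 n 0<n = pathColouring n 0<n , λ k (c , md) → LowerBound.pathValue≤k (isPathMD md) 0<n
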